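{- For every $n\ge1$ and every $e\in\mathbf{I}_n(021)$, the number of indices $i\in\{2,\ldots,n\}$ with $e_i=i-1$ equals the number of black nodes on the leftmost branch of $\tau(e)$.
   Context: An inversion sequence of length $n$ is an integer sequence $e=(e_1,\ldots,e_n)$ with $0 \le e_i < i$ for all $i$; $\mathbf{I}_n(021)$ is the set of those with no $i<j<k$ such that $e_i<e_k<e_j$. $\mathcal{T}_m$ is the set of rooted binary trees on $m$ nodes (left and right children distinguished), each node colored black or white, such that no node has the same color as its right child; $\mathcal{T}_0$ is the empty tree. The leftmost branch of a nonempty tree is the path starting at the root and repeatedly moving to the left child while one exists. For trees $T,S$, $\omega(T,S)$ (resp. $\beta(T,S)$) is the tree with a white (resp. black) root whose left subtree is $T$ and right subtree is $S$. For an integer $t$ and a sequence $(f_1,\ldots,f_m)$, $\sigma_t(f_1,\ldots,f_m)$ is obtained by adding $t$ to every nonzero entry and leaving zeros unchanged; $0^\ell$ denotes $\ell$ zeros and $\cdot$ denotes concatenation. The map $\tau:\mathbf{I}_n(021)\to\mathcal{T}_{n-1}$ is defined recursively: $\tau((0))$ is the empty tree. For $n\ge2$, let $\ell\ge1$ be the largest integer with $e_2=e_3=\cdots=e_{\ell+1}$; let $k+1$ be the smallest position $k+1>\ell+1$ with $e_{k+1}\ge k-\ell+1$, and $k=n$ if there is no such position. Then $\tau(e)=\omega\big(\tau(0^\ell\cdot\sigma_{\ell-k}(e_{k+1},\ldots,e_n)),\ \tau(0,e_{\ell+2},\ldots,e_k)\big)$ if $e_2=0$, and $\tau(e)=\beta\big(\tau(0^\ell\cdot\sigma_{\ell-k}(e_{k+1},\ldots,e_n)),\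 \tau(0,e_{\ell+2},\ldots,e_k)\big)$ if $e_2=1$. -}

module Defs where

open import Data.Nat using (ℕ; zero; suc; _+_; _∸_; _≤_; _<_; _≤ᵇ_; _≡ᵇ_)
open import Data.Bool using (Bool; true; false; if_then_else_)
open import Data.List using (List; []; _∷_; length; lookup; take; drop; replicate; map; _++_)
open import Data.Fin using (Fin; toℕ)
open import Data.Product using (_×_)
open import Relation.Nullary using (¬_)
open import Relation.Binary.PropositionalEquality using (_≡_)

-- Sequences e = (e₁,…,eₙ) are lists; position i (1-based) is list index i-1.

IsInversionSeq : List ℕ → Set
IsInversionSeq e = (p : Fin (length e)) → lookup e p < suc (toℕ p)

Avoids021 : List ℕ → Set
Avoids021 e = (i j k : Fin (length e)) → toℕ i < toℕ j → toℕ j < toℕ k →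
  ¬ (lookup e i < lookup e k × lookup e k < lookup e j)

InI021 : ℕ → List ℕ → Set
InI021 n e = length e ≡ n × IsInversionSeq e × Avoids021 e

data Color : Set where
  white black : Color

data Tree : Set where
  empty : Tree
  node  : Color → Tree → Tree → Tree

ω β : Tree → Tree → Tree
ω T S = node white T S
β T S = node black T S

blackLeftmost : Tree → ℕ
blackLeftmost empty = 0
blackLeftmost (node white l r) = blackLeftmost l
blackLeftmost (node black l r) = suc (blackLeftmost l)

run : ℕ → List ℕ → ℕ
run y [] = 0
run y (x ∷ xs) = if x ≡ᵇ y then suc (run y xs) else 0

firstBig : ℕ → List ℕ → ℕ
firstBig j [] = 0
firstBig j (x ∷ xs) = if suc (suc j) ≤ᵇ x then 0 else suc (firstBig (suc j) xs)

σneg : ℕ → ℕ → ℕ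
σneg t zero = zero
σneg t (suc x) = suc x ∸ t

-- τ with fuel (fuel = length suffices: every recursive call shortens the list)
τ' : ℕ → List ℕ → Tree
τ' zero e = empty
τ' (suc f) (x ∷ y ∷ ys) = col y
    (τ' f (replicate ℓ 0 ++ map (σneg (suc m)) (drop m s)))
    (τ' f (0 ∷ take m s))
  where
    ℓ = suc (run y ys)          -- e₂ = … = e_{ℓ+1}
    s = drop (ℓ ∸ 1) ys         -- (e_{ℓ+2},…,e_n)
    m = firstBig 0 s            -- k = ℓ + 1 + m
    col : ℕ → Tree → Tree → Tree
    col zero = ω
    col (suc zero) = β
    col (suc (suc _)) = λ _ _ → empty  -- never happens on I_n(021)
τ' (suc f) _ = empty

τ : List ℕ → Tree
τ e = τ' (length e) e

countFrom : ℕ → List ℕ → ℕ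
countFrom p [] = 0
countFrom p (x ∷ xs) = if x ≡ᵇ p then suc (countFrom (suc p) xs) else countFrom (suc p) xs

diagCount : List ℕ → ℕ
diagCount e = countFrom 1 (drop 1 e)

module Submission where

-- The left subtree of τ(e) is τ(e′) with e′ = 0^ℓ · σ_{ℓ-k}(e_{k+1},…,e_n), and
-- the root of τ(e) is black exactly when e₂ = 1, i.e. when position 2 is a
-- "diagonal" entry e_i = i - 1.  Hence the theorem follows by induction along
-- the leftmost branch once we know that e′ has exactly as many diagonal
-- entries as e has at positions 3,…,n.  That counting fact holds because
--   * the run e₃ = … = e_{ℓ+1} = e₂ ≤ 1 and the block e_{ℓ+2},…,e_k (whose
--     entries lie below the threshold defining k) contain no diagonal entry;
--   * σ_{ℓ-k} moves each remaining entry back by exactly the distance its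
--     position moves, so it preserves being diagonal;
--   * the padding zeros 0^ℓ are never diagonal.

open import Defs
open import Data.Nat using (ℕ; zero; suc; _+_; _∸_; _≤_; _<_; _≥_; _≤ᵇ_; _≡ᵇ_; z≤n; s≤s; s≤s⁻¹; _<?_)
open import Data.Nat.Properties
open import Data.Bool using (true; false; T)
open import Data.Unit using (⊤; tt)
open import Data.Product using (_×_; _,_)
open import Data.Empty using (⊥-elim)
open import Data.Fin using (Fin; toℕ) renaming (zero to fzero; suc to fsuc)
open import Data.List using (List; []; _∷_; length; lookup; drop; replicate; map; _++_)
open import Data.List.Properties using (length-++; length-replicate; length-map; length-drop)
open import Relation.Nullary using (yes; no)
open import Relation.Binary.PropositionalEquality

≡ᵇ-false : {x p : ℕ} → x < p → (x ≡ᵇ p) ≡ false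
≡ᵇ-false {zero}  {suc p} _   = refl
≡ᵇ-false {suc x} {suc p} x<p = ≡ᵇ-false (s≤s⁻¹ x<p)

≤ᵇ-false⇒> : (k x : ℕ) → (k ≤ᵇ x) ≡ false → x < k
≤ᵇ-false⇒> k x eq with x <? k
... | yes x<k = x<k
... | no x≮k  = ⊥-elim (subst T eq (≤⇒≤ᵇ (≮⇒≥ x≮k)))

∸-≡ᵇ : (a t P : ℕ) → (a ∸ t ≡ᵇ suc P) ≡ (a ≡ᵇ t + suc P)
∸-≡ᵇ a       zero    P = refl
∸-≡ᵇ zero    (suc t) P = refl
∸-≡ᵇ (suc a) (suc t) P = ∸-≡ᵇ a t P

σneg-≡ᵇ : (t x P : ℕ) → (σneg t x ≡ᵇ suc P) ≡ (x ≡ᵇ suc P + t)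
σneg-≡ᵇ zero    zero    P = refl
σneg-≡ᵇ (suc t) zero    P = refl
σneg-≡ᵇ t       (suc x) P = trans (∸-≡ᵇ (suc x) t P) (cong (suc x ≡ᵇ_) (+-comm t (suc P)))

-- countFrom p xs counts the "diagonal" entries of xs when its first entry sits
-- at a position whose diagonal value is p.  An entry strictly below its
-- diagonal value is never counted; `BelowFrom p r xs` says this holds for the
-- first r entries, which may then be skipped.

BelowFrom : ℕ → ℕ → List ℕ → Set
BelowFrom p zero    xs       = ⊤
BelowFrom p (suc r) []       = ⊤
BelowFrom p (suc r) (x ∷ xs) = x < p × BelowFrom (suc p) r xs

countFrom-skip : (p r : ℕ) (xs : List ℕ) → BelowFrom p r xs →
  countFrom p xs ≡ countFrom (p + r) (drop r xs)
countFrom-skip p zero    xs       _ = cong (λ q → countFrom q xs) (sym (+-identityʳ p))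
countFrom-skip p (suc r) []       _ = refl
countFrom-skip p (suc r) (x ∷ xs) (x<p , below)
  rewrite ≡ᵇ-false x<p | +-suc p r = countFrom-skip (suc p) r xs below

run-below : (p y : ℕ) → y < p → (ys : List ℕ) → BelowFrom p (run y ys) ys
run-below p y y<p []       = tt
run-below p y y<p (x ∷ xs) with x ≡ᵇ y in eq
... | true  = subst (_< p) (sym (≡ᵇ⇒≡ x y (subst T (sym eq) tt))) y<p
            , run-below (suc p) y (<-trans y<p (n<1+n p)) xs
... | false = tt

firstBig-below : (j p : ℕ) → 2 + j ≤ p → (s : List ℕ) → BelowFrom p (firstBig j s) s
firstBig-below j p le []       = tt
firstBig-below j p le (x ∷ xs) with 2 + j ≤ᵇ x in eq
... | true  = tt
... | false = <-≤-trans (≤ᵇ-false⇒> (2 + j) x eq) le , firstBig-below (suc j) (suc p) (s≤s le) xs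

countFrom-zeros : (p r : ℕ) (xs : List ℕ) →
  countFrom (suc p) (replicate r 0 ++ xs) ≡ countFrom (suc p + r) xs
countFrom-zeros p zero    xs = cong (λ q → countFrom q xs) (sym (+-identityʳ (suc p)))
countFrom-zeros p (suc r) xs rewrite +-suc p r = countFrom-zeros (suc p) r xs

countFrom-σneg : (t P : ℕ) (xs : List ℕ) →
  countFrom (suc P + t) xs ≡ countFrom (suc P) (map (σneg t) xs)
countFrom-σneg t P []       = refl
countFrom-σneg t P (x ∷ xs) rewrite σneg-≡ᵇ t x P | countFrom-σneg t (suc P) xs = refl

BoundedFrom : ℕ → List ℕ → Set
BoundedFrom j []       = ⊤
BoundedFrom j (x ∷ xs) = x ≤ j × BoundedFrom (suc j) xs

bounded-lookup : (j : ℕ) (xs : List ℕ) →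
  ((p : Fin (length xs)) → lookup xs p ≤ j + toℕ p) → BoundedFrom j xs
bounded-lookup j []       _     = tt
bounded-lookup j (x ∷ xs) bound =
  subst (x ≤_) (+-identityʳ j) (bound fzero) ,
  bounded-lookup (suc j) xs (λ p → subst (lookup xs p ≤_) (+-suc j (toℕ p)) (bound (fsuc p)))

inversion⇒bounded : (e : List ℕ) → IsInversionSeq e → BoundedFrom 0 e
inversion⇒bounded e inv = bounded-lookup 0 e (λ p → s≤s⁻¹ (inv p))

bounded-drop : (j n : ℕ) (xs : List ℕ) → BoundedFrom j xs → BoundedFrom (j + n) (drop n xs)
bounded-drop j zero    xs       h = subst (λ q → BoundedFrom q xs) (sym (+-identityʳ j)) h
bounded-drop j (suc n) []       h = tt
bounded-drop j (suc n) (x ∷ xs) (_ , h) rewrite +-suc j n = bounded-drop (suc j) n xs h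

bounded-σneg : (q t : ℕ) (xs : List ℕ) → BoundedFrom (q + t) xs → BoundedFrom q (map (σneg t) xs)
bounded-σneg q t []            h        = tt
bounded-σneg q t (zero  ∷ xs) (_  , h) = z≤n , bounded-σneg (suc q) t xs h
bounded-σneg q t (suc x ∷ xs) (le , h) =
  m≤n+o⇒m∸n≤o (suc x) t (subst (suc x ≤_) (+-comm q t) le) , bounded-σneg (suc q) t xs h

bounded-zeros : (j r : ℕ) (xs : List ℕ) → BoundedFrom (j + r) xs → BoundedFrom j (replicate r 0 ++ xs)
bounded-zeros j zero    xs h = subst (λ q → BoundedFrom q xs) (+-identityʳ j) h
bounded-zeros j (suc r) xs h = z≤n , bounded-zeros (suc j) r xs (subst (λ q → BoundedFrom q xs) (+-suc j r) h)

-- The sequence whose τ-image is the left subtree of τ(x ∷ y ∷ ys): with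
-- r = ℓ - 1 the length of the run of y, and m = k - ℓ - 1 the length of the
-- block before the first big entry, it is 0^ℓ · σ_{ℓ-k}(e_{k+1},…,e_n).

leftSeq : ℕ → List ℕ → List ℕ
leftSeq y ys = replicate (suc r) 0 ++ map (σneg (suc m)) (drop m s)
  where
    r = run y ys
    s = drop r ys
    m = firstBig 0 s

-- Position bookkeeping: the suffix starts at diagonal value 2 + r + m, which
-- is (r + 1) + (m + 1) as needed for σ_{-(m+1)}.
suffix-offset : (r m : ℕ) → 2 + r + m ≡ suc r + suc m
suffix-offset r m = cong suc (sym (+-suc r m))

leftSeq-diagCount : (y : ℕ) → y ≤ 1 → (ys : List ℕ) → countFrom 2 ys ≡ diagCount (leftSeq y ys)
leftSeq-diagCount y y≤1 ys = begin
  countFrom 2 ys                         ≡⟨ countFrom-skip 2 r ys (run-below 2 y (s≤s y≤1) ys) ⟩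
  countFrom (2 + r) s                    ≡⟨ countFrom-skip (2 + r) m s (firstBig-below 0 (2 + r) (s≤s (s≤s z≤n)) s) ⟩
  countFrom (2 + r + m) (drop m s)       ≡⟨ cong (λ q → countFrom q (drop m s)) (suffix-offset r m) ⟩
  countFrom (suc r + suc m) (drop m s)   ≡⟨ countFrom-σneg (suc m) r (drop m s) ⟩
  countFrom (suc r) (map (σneg (suc m)) (drop m s))
                                         ≡⟨ countFrom-zeros 0 r _ ⟨
  countFrom 1 (replicate r 0 ++ map (σneg (suc m)) (drop m s)) ∎
  where
    open ≡-Reasoning
    r = run y ys
    s = drop r ys
    m = firstBig 0 s

leftSeq-bounded : (y : ℕ) (ys : List ℕ) → BoundedFrom 2 ys → BoundedFrom 0 (leftSeq y ys)
leftSeq-bounded y ys h =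
  z≤n , bounded-zeros 1 r _ (bounded-σneg (suc r) (suc m) _
          (subst (λ q → BoundedFrom q (drop m s)) (suffix-offset r m)
            (bounded-drop (2 + r) m s (bounded-drop 2 r ys h))))
  where
    r = run y ys
    s = drop r ys
    m = firstBig 0 s

run≤length : (y : ℕ) (ys : List ℕ) → run y ys ≤ length ys
run≤length y []       = z≤n
run≤length y (x ∷ xs) with x ≡ᵇ y
... | true  = s≤s (run≤length y xs)
... | false = z≤n

leftSeq-length : (y : ℕ) (ys : List ℕ) → length (leftSeq y ys) ≤ suc (length ys)
leftSeq-length y ys = s≤s (begin
  length (replicate r 0 ++ map (σneg (suc m)) (drop m s))
      ≡⟨ trans (length-++ (replicate r 0)) (cong (_+ length (map (σneg (suc m)) (drop m s))) (length-replicate r)) ⟩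
  r + length (map (σneg (suc m)) (drop m s)) ≡⟨ cong (r +_) (length-map (σneg (suc m)) (drop m s)) ⟩
  r + length (drop m s)                       ≡⟨ cong (r +_) (trans (length-drop m s) (cong (_∸ m) (length-drop r ys))) ⟩
  r + (length ys ∸ r ∸ m)                     ≤⟨ +-monoʳ-≤ r (m∸n≤m (length ys ∸ r) m) ⟩
  r + (length ys ∸ r)                         ≡⟨ m+[n∸m]≡n (run≤length y ys) ⟩
  length ys                                   ∎)
  where
    open ≤-Reasoning
    r = run y ys
    s = drop r ys
    m = firstBig 0 s

-- The theorem for τ with any sufficient fuel, by induction on the fuel along
-- the leftmost branch.  The root is black iff e₂ = 1, which is exactly the
-- diagonal entry at position 2.
diagCount≡blackLeftmost : (f : ℕ) (e : List ℕ) → BoundedFrom 0 e → length e ≤ f →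
  diagCount e ≡ blackLeftmost (τ' f e)
diagCount≡blackLeftmost zero    []      _ _ = refl
diagCount≡blackLeftmost (suc f) []      _ _ = refl
diagCount≡blackLeftmost zero    (x ∷ []) _ _ = refl
diagCount≡blackLeftmost (suc f) (x ∷ []) _ _ = refl
diagCount≡blackLeftmost zero    (x ∷ y ∷ ys) _ ()
diagCount≡blackLeftmost (suc f) (x ∷ suc (suc y) ∷ ys) (_ , s≤s () , _) _
diagCount≡blackLeftmost (suc f) (x ∷ zero ∷ ys) (_ , _ , h) (s≤s len) =
  trans (leftSeq-diagCount 0 z≤n ys)
        (diagCount≡blackLeftmost f (leftSeq 0 ys) (leftSeq-bounded 0 ys h) (≤-trans (leftSeq-length 0 ys) len))
diagCount≡blackLeftmost (suc f) (x ∷ suc zero ∷ ys) (_ , _ , h) (s≤s len) =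
  cong suc (trans (leftSeq-diagCount 1 ≤-refl ys)
        (diagCount≡blackLeftmost f (leftSeq 1 ys) (leftSeq-bounded 1 ys h) (≤-trans (leftSeq-length 1 ys) len)))

theorem16 : (n : ℕ) → n ≥ 1 → (e : List ℕ) → InI021 n e →
    diagCount e ≡ blackLeftmost (τ e)
theorem16 n _ e (_ , inv , _) =
  diagCount≡blackLeftmost (length e) e (inversion⇒bounded e inv) ≤-refl
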